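{- Let $m,n$ be positive integers and let $p$ be an odd prime not dividing $m$. For $r\in\mathbb Z$ define $$K_p(r,m)=\sum_{\substack{k=1\\ m\mid k-rp}}^{p-1}\frac1k.$$ Then $$K_p(r,m)=\sum_{\substack{l=1\\ m\mid l-(1-r)p}}^{p-1}\frac1{p-l}\equiv-K_p(1-r,m)\pmod p$$ for every $r\in\mathbb Z$, and $$B_{p-1}\left(\left\{\frac{pn}m\right\}\right)-B_{p-1}\equiv m\sum_{r=1}^nK_p(r,m)\equiv-\sum_{\substack{k=1\\ p\nmid k}}^{\lfloor pn/m\rfloor}\frac1k\pmod p.$$
   Context: $\{x\}$ denotes the fractional part and $\lfloor x\rfloor$ the integer part of $x$; $B_n(x)$ is the $n$-th Bernoulli polynomial and $B_n=B_n(0)$. Congruences are between rational numbers with denominators prime to $p$. -}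

module Defs where

open import Data.Nat as ℕ using (ℕ; zero; suc; _∸_)
open import Data.Nat.Divisibility as ℕD using (_∣?_)
open import Data.Nat.Combinatorics using (_C_)
open import Data.Integer as ℤ using (ℤ; +_)
open import Data.Rational as ℚ using (ℚ; 0ℚ; 1ℚ; ↥_; ↧ₙ_)
open import Data.List using (List; []; _∷_; _++_; length; zipWith; upTo; foldr)
open import Data.Product using (_×_)
open import Relation.Nullary using (¬_)
open import Relation.Nullary.Decidable using (⌊_⌋)
open import Data.Bool using (if_then_else_)

ι : ℕ → ℚ
ι k = (+ k) ℚ./ 1

-- 1/k for k ≥ 1 (value at k = 0 is irrelevant, set to 0)
recip : ℕ → ℚ
recip zero = 0ℚ
recip (suc k) = (+ 1) ℚ./ suc k

Σ₁ : ℕ → (ℕ → ℚ) → ℚ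
Σ₁ zero f = 0ℚ
Σ₁ (suc n) f = Σ₁ n f ℚ.+ f (suc n)

Σ₀ : ℕ → (ℕ → ℚ) → ℚ
Σ₀ n f = f 0 ℚ.+ Σ₁ n f

_^_ : ℚ → ℕ → ℚ
x ^ zero = 1ℚ
x ^ suc n = x ℚ.* (x ^ n)

-- integer divisibility m ∣ a, decided (ℤ divisibility is |m| ∣ |a|)
divBool : ℕ → ℤ → Data.Bool.Bool
divBool m a = ⌊ m ∣? ℤ.∣ a ∣ ⌋

K : ℕ → ℤ → ℕ → ℚ
K p r m = Σ₁ (p ∸ 1) (λ k → if divBool m ((+ k) ℤ.- r ℤ.* (+ p)) then recip k else 0ℚ)

K′ : ℕ → ℤ → ℕ → ℚ
K′ p r m = Σ₁ (p ∸ 1)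
  (λ l → if divBool m ((+ l) ℤ.- ((+ 1) ℤ.- r) ℤ.* (+ p)) then recip (p ∸ l) else 0ℚ)

-- Bernoulli numbers, B_0 = 1, Σ_{k=0}^{n} C(n+1,k) B_k = 0 for n ≥ 1 (so B_1 = -1/2)
-- bsum N [B_0,…,B_{j-1}] = Σ_{k<j} C(N,k) B_k
bsum : ℕ → List ℚ → ℚ
bsum N bs = foldr ℚ._+_ 0ℚ (zipWith (λ k b → ι (N C k) ℚ.* b) (upTo (length bs)) bs)

-- next n [B_0,…,B_{n-1}] = B_n
nextB : ℕ → List ℚ → ℚ
nextB zero bs = 1ℚ
nextB (suc n) bs = ℚ.- (((+ 1) ℚ./ suc (suc n)) ℚ.* bsum (suc (suc n)) bs)

bernList : ℕ → List ℚ
bernList zero = []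
bernList (suc n) = bernList n ++ (nextB n (bernList n) ∷ [])

bernoulli : ℕ → ℚ
bernoulli n = nextB n (bernList n)

bernPoly : ℕ → ℚ → ℚ
bernPoly n x = Σ₀ n (λ k → ι (n C k) ℚ.* (bernoulli k ℚ.* (x ^ (n ∸ k))))

CongModℚ : ℕ → ℚ → ℚ → Set
CongModℚ p a b = (p ℕD.∣ ℤ.∣ ↥ (a ℚ.- b) ∣) × ¬ (p ℕD.∣ ↧ₙ (a ℚ.- b))

{-# OPTIONS --safe #-}
-- K_p(r,m) = K′_p(r,m) is the substitution k = p − l, and 1/(p − l) ≡ −1/l gives K_p(r,m) ≡ −K_p(1−r,m).
-- In the same way 1/(p − l) ≡ −1/((r−1)p + l), so K_p(r,m) is minus the sum of 1/u over the u in the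
-- r-th block of p consecutive integers with m ∣ u and p ∤ u; over r ≤ n these u are the mi ≤ pn, and
-- m/(mi) = 1/i.  On the Bernoulli side c = pn/m is p-integral with c ≡ 0 and {c} = c − N, N = ⌊pn/m⌋.
-- The B_k with k < p − 1 are p-integral, so B_{p−1}(c) ≡ B_{p−1}, and B_{p−1}(x+1) − B_{p−1}(x) =
-- (p−1)x^{p−2} telescopes to B_{p−1}(c) − B_{p−1}(c − N) = Σ_{i≤N} (p−1)(c−i)^{p−2}, whose terms are
-- ≡ 1/i or 0 by Fermat's little theorem.

module Submission where

open import Defs
open import Data.Nat as ℕ using (ℕ; zero; suc; _∸_; _≤_; _<_; z≤n; s≤s; _!; NonZero)
import Data.Nat.Properties as ℕP
import Data.Nat.Coprimality as ℕC
import Data.Nat.GCD as ℕG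
open import Data.Nat.Divisibility as ℕD using (_∣_; _∣?_)
open import Data.Nat.DivMod using (m≡m%n+[m/n]*n; m%n<n; m*n/o*n≡m/o; m/n*n≡m; /-congʳ)
open import Data.Nat.Primality using (Prime; euclidsLemma; prime⇒nonZero; prime⇒nonTrivial)
open import Data.Nat.Combinatorics using (_C_; nCk+nC[k+1]≡[n+1]C[k+1]; nCn≡1; nC1≡n; nCk≡nC[n∸k]; k![n∸k]!∣n!)
open import Data.Nat.Combinatorics.Specification using (k>n⇒nCk≡0; nCk≡n!/k![n-k]!)
open import Data.Integer as ℤ using (ℤ; +_; -[1+_])
import Data.Integer.Properties as ℤP
import Data.Integer.Divisibility.Signed as ℤD
import Data.Integer.GCD as ℤG
open import Data.Integer.DivMod using (div-pos-is-/ℕ)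
open import Data.Integer.Tactic.RingSolver using (solve-∀)
open import Data.Rational as ℚ using (ℚ; mkℚ; 0ℚ; 1ℚ; ↥_; ↧_; ↧ₙ_; _/_; fracPart)
import Data.Rational.Properties as ℚP
open import Data.Rational.Solver using (module +-*-Solver)
open +-*-Solver
open import Data.List using (List; []; _∷_; _++_; length; zipWith; upTo; foldr)
import Data.List.Properties as ListP
open import Data.Bool as Bool using (Bool; true; false; if_then_else_)
open import Data.Empty using (⊥-elim)
open import Data.Product using (_×_; _,_)
open import Data.Sum using (inj₁; inj₂)
open import Relation.Binary.Bundles using (Setoid)
open import Relation.Binary.PropositionalEquality using (_≡_; _≢_; refl; sym; trans; cong; cong₂; subst; module ≡-Reasoning)
open import Relation.Nullary using (¬_; yes; no)
open import Relation.Nullary.Decidable using (⌊_⌋)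

[n∸1]*m+m≡n*m : ∀ n .{{_ : NonZero n}} m → (n ∸ 1) ℕ.* m ℕ.+ m ≡ n ℕ.* m
[n∸1]*m+m≡n*m (suc n) m = ℕP.+-comm (n ℕ.* m) m

n∣n! : ∀ n .{{_ : NonZero n}} → n ∣ n !
n∣n! (suc n) = ℕD.m∣m*n (n !)

m∸n+[o+n]≡m+o : ∀ {m n} → n ≤ m → ∀ o → m ∸ n ℕ.+ (o ℕ.+ n) ≡ m ℕ.+ o
m∸n+[o+n]≡m+o {m} {n} n≤m o = begin
  m ∸ n ℕ.+ (o ℕ.+ n)    ≡⟨ cong (m ∸ n ℕ.+_) (ℕP.+-comm o n) ⟩
  m ∸ n ℕ.+ (n ℕ.+ o)    ≡⟨ ℕP.+-assoc (m ∸ n) n o ⟨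
  (m ∸ n ℕ.+ n) ℕ.+ o    ≡⟨ cong (ℕ._+ o) (ℕP.m∸n+n≡m n≤m) ⟩
  m ℕ.+ o                ∎
  where open ≡-Reasoning

p≢2⇒p∸2≢0 : ∀ {p} → Prime p → p ≢ 2 → NonZero (p ∸ 2)
p≢2⇒p∸2≢0 {0}                 ()
p≢2⇒p∸2≢0 {1}                 ()
p≢2⇒p∸2≢0 {2}                 _ p≢2 = ⊥-elim (p≢2 refl)
p≢2⇒p∸2≢0 {suc (suc (suc _))} _ _   = _

ι-mkℚ : ∀ a → ι a ≡ mkℚ (+ a) 0 (ℕC.sym (ℕC.1-coprimeTo a))
ι-mkℚ a = ℚP.normalize-coprime (ℕC.sym (ℕC.1-coprimeTo a))

recip-mkℚ : ∀ k → recip (suc k) ≡ mkℚ (+ 1) k (ℕC.1-coprimeTo (suc k))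
recip-mkℚ k = ℚP.normalize-coprime (ℕC.1-coprimeTo (suc k))

ι-+ : ∀ a b → ι (a ℕ.+ b) ≡ ι a ℚ.+ ι b
ι-+ a b rewrite ι-mkℚ a | ι-mkℚ b = ℚP./-cong {p₁ = + (a ℕ.+ b)} {q₁ = 1}
  (trans (ℤP.pos-+ a b) (sym (cong₂ ℤ._+_ (ℤP.*-identityʳ (+ a)) (ℤP.*-identityʳ (+ b))))) refl

ι-* : ∀ a b → ι (a ℕ.* b) ≡ ι a ℚ.* ι b
ι-* a b rewrite ι-mkℚ a | ι-mkℚ b = ℚP./-cong {p₁ = + (a ℕ.* b)} {q₁ = 1} (ℤP.pos-* a b) refl

ι-suc : ∀ a → ι (suc a) ≡ ι a ℚ.+ 1ℚ
ι-suc a = trans (cong ι (ℕP.+-comm 1 a)) (ι-+ a 1)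

/≡ι*recip : ∀ a k → (+ a) / suc k ≡ ι a ℚ.* recip (suc k)
/≡ι*recip a k rewrite ι-mkℚ a | recip-mkℚ k = ℚP./-cong {p₁ = + a} {q₁ = suc k}
  (sym (ℤP.*-identityʳ (+ a))) (sym (ℕP.*-identityˡ (suc k)))

ι*recip : ∀ k .{{_ : NonZero k}} → ι k ℚ.* recip k ≡ 1ℚ
ι*recip (suc k) rewrite ι-mkℚ (suc k) | recip-mkℚ k =
  ℚP.*-inverseʳ (mkℚ (+ suc k) 0 (ℕC.sym (ℕC.1-coprimeTo (suc k))))

recip*ι : ∀ k .{{_ : NonZero k}} → recip k ℚ.* ι k ≡ 1ℚ
recip*ι k = trans (ℚP.*-comm (recip k) (ι k)) (ι*recip k)

recip*[recip*ι^[2+q]]≡ι^q : ∀ i .{{_ : NonZero i}} q → recip i ℚ.* (recip i ℚ.* (ι i ^ (2 ℕ.+ q))) ≡ ι i ^ q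
recip*[recip*ι^[2+q]]≡ι^q i q = begin
  r ℚ.* (r ℚ.* (x ℚ.* (x ℚ.* x ^ q)))   ≡⟨ solve 3 (λ r x w → r :* (r :* (x :* (x :* w))) := (r :* x) :* ((r :* x) :* w))
                                               refl r x (x ^ q) ⟩
  (r ℚ.* x) ℚ.* ((r ℚ.* x) ℚ.* x ^ q)   ≡⟨ cong (λ t → t ℚ.* (t ℚ.* x ^ q)) (recip*ι i) ⟩
  1ℚ ℚ.* (1ℚ ℚ.* x ^ q)                 ≡⟨ solve 1 (λ w → con 1ℚ :* (con 1ℚ :* w) := w) refl (x ^ q) ⟩
  x ^ q                                 ∎
  where
  open ≡-Reasoning
  x = ι i
  r = recip i

ι[m]*recip[i*m]≡recip[i] : ∀ i m .{{_ : NonZero i}} .{{_ : NonZero m}} →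
  ι m ℚ.* recip (i ℕ.* m) ≡ recip i
ι[m]*recip[i*m]≡recip[i] i m = begin
  ι m ℚ.* r[im]                            ≡⟨ sym (ℚP.*-identityˡ _) ⟩
  1ℚ ℚ.* (ι m ℚ.* r[im])                   ≡⟨ cong (ℚ._* (ι m ℚ.* r[im])) (sym (recip*ι i)) ⟩
  (recip i ℚ.* ι i) ℚ.* (ι m ℚ.* r[im])    ≡⟨ solve 4 (λ a b c d → (a :* b) :* (c :* d) := a :* ((b :* c) :* d))
                                                refl (recip i) (ι i) (ι m) r[im] ⟩
  recip i ℚ.* ((ι i ℚ.* ι m) ℚ.* r[im])    ≡⟨ cong (λ t → recip i ℚ.* (t ℚ.* r[im])) (sym (ι-* i m)) ⟩
  recip i ℚ.* (ι (i ℕ.* m) ℚ.* r[im])      ≡⟨ cong (recip i ℚ.*_) (ι*recip (i ℕ.* m)) ⟩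
  recip i ℚ.* 1ℚ                           ≡⟨ ℚP.*-identityʳ (recip i) ⟩
  recip i                                  ∎
  where
  open ≡-Reasoning
  instance _ = ℕP.m*n≢0 i m
  r[im] = recip (i ℕ.* m)

^-zeroˡ : ∀ e → 1ℚ ^ e ≡ 1ℚ
^-zeroˡ zero    = refl
^-zeroˡ (suc e) = trans (ℚP.*-identityˡ (1ℚ ^ e)) (^-zeroˡ e)

recip+recip≡recip*recip*ι[+] : ∀ a b .{{_ : NonZero a}} .{{_ : NonZero b}} →
  recip a ℚ.+ recip b ≡ (recip a ℚ.* recip b) ℚ.* ι (a ℕ.+ b)
recip+recip≡recip*recip*ι[+] a b = begin
  recip a ℚ.+ recip b
    ≡⟨ solve 2 (λ x y → x :+ y := y :* con 1ℚ :+ x :* con 1ℚ) refl (recip a) (recip b) ⟩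
  recip b ℚ.* 1ℚ ℚ.+ recip a ℚ.* 1ℚ
    ≡⟨ cong₂ (λ s t → recip b ℚ.* s ℚ.+ recip a ℚ.* t) (recip*ι a) (recip*ι b) ⟨
  recip b ℚ.* (recip a ℚ.* ι a) ℚ.+ recip a ℚ.* (recip b ℚ.* ι b)
    ≡⟨ solve 4 (λ x y u v → y :* (x :* u) :+ x :* (y :* v) := (x :* y) :* (u :+ v)) refl (recip a) (recip b) (ι a) (ι b) ⟩
  (recip a ℚ.* recip b) ℚ.* (ι a ℚ.+ ι b)
    ≡⟨ cong ((recip a ℚ.* recip b) ℚ.*_) (ι-+ a b) ⟨
  (recip a ℚ.* recip b) ℚ.* ι (a ℕ.+ b) ∎
  where open ≡-Reasoning

-- Finite sums

Σ< : ℕ → (ℕ → ℚ) → ℚ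
Σ< zero    f = 0ℚ
Σ< (suc n) f = Σ< n f ℚ.+ f n

Σ<-cong : ∀ n {f g} → (∀ k → k < n → f k ≡ g k) → Σ< n f ≡ Σ< n g
Σ<-cong zero    f≡g = refl
Σ<-cong (suc n) f≡g = cong₂ ℚ._+_ (Σ<-cong n (λ k k<n → f≡g k (ℕP.m<n⇒m<1+n k<n))) (f≡g n ℕP.≤-refl)

Σ<-suc : ∀ n f → Σ< (suc n) f ≡ f 0 ℚ.+ Σ< n (λ k → f (suc k))
Σ<-suc zero    f = trans (ℚP.+-identityˡ (f 0)) (sym (ℚP.+-identityʳ (f 0)))
Σ<-suc (suc n) f = trans (cong (ℚ._+ f (suc n)) (Σ<-suc n f)) (ℚP.+-assoc (f 0) _ _)

Σ<-+ : ∀ n f g → Σ< n (λ k → f k ℚ.+ g k) ≡ Σ< n f ℚ.+ Σ< n g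
Σ<-+ zero    f g = refl
Σ<-+ (suc n) f g rewrite Σ<-+ n f g =
  solve 4 (λ a b c d → (a :+ b) :+ (c :+ d) := (a :+ c) :+ (b :+ d)) refl (Σ< n f) (Σ< n g) (f n) (g n)

Σ<-*ˡ : ∀ n c f → Σ< n (λ k → c ℚ.* f k) ≡ c ℚ.* Σ< n f
Σ<-*ˡ zero    c f = sym (ℚP.*-zeroʳ c)
Σ<-*ˡ (suc n) c f rewrite Σ<-*ˡ n c f = sym (ℚP.*-distribˡ-+ c (Σ< n f) (f n))

Σ<-zero : ∀ n {f} → (∀ k → k < n → f k ≡ 0ℚ) → Σ< n f ≡ 0ℚ
Σ<-zero n f≡0 = trans (Σ<-cong n f≡0) (Σ<-const0 n)
  where
  Σ<-const0 : ∀ n → Σ< n (λ _ → 0ℚ) ≡ 0ℚ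
  Σ<-const0 zero    = refl
  Σ<-const0 (suc n) rewrite Σ<-const0 n = refl

Σ₁≡Σ< : ∀ n f → Σ₁ n f ≡ Σ< n (λ k → f (suc k))
Σ₁≡Σ< zero    f = refl
Σ₁≡Σ< (suc n) f = cong (ℚ._+ f (suc n)) (Σ₁≡Σ< n f)

Σ₀≡Σ< : ∀ n f → Σ₀ n f ≡ Σ< (suc n) f
Σ₀≡Σ< n f = trans (cong (f 0 ℚ.+_) (Σ₁≡Σ< n f)) (sym (Σ<-suc n f))

Σ₁-cong : ∀ n {f g} → (∀ k → 1 ≤ k → k ≤ n → f k ≡ g k) → Σ₁ n f ≡ Σ₁ n g
Σ₁-cong zero    f≡g = refl
Σ₁-cong (suc n) f≡g =
  cong₂ ℚ._+_ (Σ₁-cong n (λ k 1≤k k≤n → f≡g k 1≤k (ℕP.m≤n⇒m≤1+n k≤n))) (f≡g (suc n) (s≤s z≤n) ℕP.≤-refl)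

Σ₁-suc : ∀ n f → Σ₁ (suc n) f ≡ f 1 ℚ.+ Σ₁ n (λ k → f (suc k))
Σ₁-suc zero    f = trans (ℚP.+-identityˡ (f 1)) (sym (ℚP.+-identityʳ (f 1)))
Σ₁-suc (suc n) f = trans (cong (ℚ._+ f (suc (suc n))) (Σ₁-suc n f)) (ℚP.+-assoc (f 1) _ _)

Σ₁-+ : ∀ a b f → Σ₁ (a ℕ.+ b) f ≡ Σ₁ a f ℚ.+ Σ₁ b (λ k → f (a ℕ.+ k))
Σ₁-+ a zero    f rewrite ℕP.+-identityʳ a = sym (ℚP.+-identityʳ _)
Σ₁-+ a (suc b) f rewrite ℕP.+-suc a b | Σ₁-+ a b f =
  ℚP.+-assoc (Σ₁ a f) (Σ₁ b (λ k → f (a ℕ.+ k))) (f (suc (a ℕ.+ b)))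

Σ₁-reverse : ∀ n f → Σ₁ n f ≡ Σ₁ n (λ l → f (suc n ∸ l))
Σ₁-reverse zero    f = refl
Σ₁-reverse (suc n) f = begin
  Σ₁ n f ℚ.+ f (suc n)                       ≡⟨ ℚP.+-comm (Σ₁ n f) (f (suc n)) ⟩
  f (suc n) ℚ.+ Σ₁ n f                       ≡⟨ cong (f (suc n) ℚ.+_) (Σ₁-reverse n f) ⟩
  f (suc n) ℚ.+ Σ₁ n (λ l → f (suc n ∸ l))   ≡⟨ Σ₁-suc n (λ l → f (suc (suc n) ∸ l)) ⟨
  Σ₁ (suc n) (λ l → f (suc (suc n) ∸ l))     ∎
  where open ≡-Reasoning

Σ₁-*ˡ : ∀ n c f → Σ₁ n (λ k → c ℚ.* f k) ≡ c ℚ.* Σ₁ n f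
Σ₁-*ˡ zero    c f = sym (ℚP.*-zeroʳ c)
Σ₁-*ˡ (suc n) c f rewrite Σ₁-*ˡ n c f = sym (ℚP.*-distribˡ-+ c (Σ₁ n f) (f (suc n)))

Σ₁-neg : ∀ n f → Σ₁ n (λ k → ℚ.- f k) ≡ ℚ.- Σ₁ n f
Σ₁-neg zero    f = refl
Σ₁-neg (suc n) f rewrite Σ₁-neg n f = sym (ℚP.neg-distrib-+ (Σ₁ n f) (f (suc n)))

Σ₁-zero : ∀ n {f} → (∀ k → 1 ≤ k → k ≤ n → f k ≡ 0ℚ) → Σ₁ n f ≡ 0ℚ
Σ₁-zero n {f} f≡0 = trans (Σ₁≡Σ< n f) (Σ<-zero n (λ k k<n → f≡0 (suc k) (s≤s z≤n) k<n))

Σ₁-blocks : ∀ b n f → Σ₁ (n ℕ.* b) f ≡ Σ₁ n (λ r → Σ₁ b (λ v → f ((r ∸ 1) ℕ.* b ℕ.+ v)))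
Σ₁-blocks b zero    f = refl
Σ₁-blocks b (suc n) f rewrite ℕP.+-comm b (n ℕ.* b) | Σ₁-+ (n ℕ.* b) b f | Σ₁-blocks b n f = refl
divBool-yes : ∀ m k → m ∣ k → divBool m (+ k) ≡ true
divBool-yes m k m∣k with m ∣? k
... | yes _   = refl
... | no m∤k = ⊥-elim (m∤k m∣k)

divBool-no : ∀ m k → ¬ m ∣ k → divBool m (+ k) ≡ false
divBool-no m k m∤k with m ∣? k
... | yes m∣k = ⊥-elim (m∤k m∣k)
... | no _    = refl

if-then-0-else-0 : ∀ b → (if b then 0ℚ else 0ℚ) ≡ 0ℚ
if-then-0-else-0 true  = refl
if-then-0-else-0 false = refl

Σ₁-last : ∀ n .{{_ : NonZero n}} f → Σ₁ n f ≡ Σ₁ (n ∸ 1) f ℚ.+ f n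
Σ₁-last (suc n) f = refl

onMultiplesOf : ℕ → (ℕ → ℚ) → ℕ → ℚ
onMultiplesOf m f u = if divBool m (+ u) then f u else 0ℚ

Σ₁-onMultiplesOf : ∀ m .{{_ : NonZero m}} N f →
  Σ₁ N (onMultiplesOf m f) ≡ Σ₁ (N ℕ./ m) (λ i → f (i ℕ.* m))
Σ₁-onMultiplesOf m@(suc m′) N f = begin
  Σ₁ N F
    ≡⟨ cong (λ k → Σ₁ k F) N≡Q*m+R ⟩
  Σ₁ (Q ℕ.* m ℕ.+ R) F
    ≡⟨ Σ₁-+ (Q ℕ.* m) R F ⟩
  Σ₁ (Q ℕ.* m) F ℚ.+ Σ₁ R (λ v → F (Q ℕ.* m ℕ.+ v))
    ≡⟨ cong (Σ₁ (Q ℕ.* m) F ℚ.+_) (Σ₁-zero R (λ v 1≤v v≤R → F[i*m+v]≡0 Q v 1≤v (ℕP.≤-<-trans v≤R (m%n<n N m)))) ⟩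
  Σ₁ (Q ℕ.* m) F ℚ.+ 0ℚ
    ≡⟨ ℚP.+-identityʳ _ ⟩
  Σ₁ (Q ℕ.* m) F
    ≡⟨ Σ₁-blocks m Q F ⟩
  Σ₁ Q (λ i → Σ₁ m (λ v → F ((i ∸ 1) ℕ.* m ℕ.+ v)))
    ≡⟨ Σ₁-cong Q (λ i 1≤i _ → block i 1≤i) ⟩
  Σ₁ Q (λ i → f (i ℕ.* m)) ∎
  where
  open ≡-Reasoning
  F = onMultiplesOf m f
  Q = N ℕ./ m
  R = N ℕ.% m
  N≡Q*m+R : N ≡ Q ℕ.* m ℕ.+ R
  N≡Q*m+R = trans (m≡m%n+[m/n]*n N m) (ℕP.+-comm R (Q ℕ.* m))
  F[i*m+v]≡0 : ∀ i v → 1 ≤ v → v < m → F (i ℕ.* m ℕ.+ v) ≡ 0ℚ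
  F[i*m+v]≡0 i v@(suc _) _ v<m rewrite divBool-no m (i ℕ.* m ℕ.+ v)
    (λ m∣i*m+v → ℕD.>⇒∤ v<m (ℕD.∣m+n∣m⇒∣n m∣i*m+v (ℕD.n∣m*n i))) = refl
  block : ∀ i → 1 ≤ i → Σ₁ m (λ v → F ((i ∸ 1) ℕ.* m ℕ.+ v)) ≡ f (i ℕ.* m)
  block i@(suc i′) _ = begin
    Σ₁ m′ (λ v → F (i′ ℕ.* m ℕ.+ v)) ℚ.+ F (i′ ℕ.* m ℕ.+ m)
      ≡⟨ cong₂ ℚ._+_ (Σ₁-zero m′ (λ v 1≤v v≤m′ → F[i*m+v]≡0 i′ v 1≤v (s≤s v≤m′)))
                     (cong F (ℕP.+-comm (i′ ℕ.* m) m)) ⟩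
    0ℚ ℚ.+ F (i ℕ.* m)
      ≡⟨ ℚP.+-identityˡ _ ⟩
    F (i ℕ.* m)
      ≡⟨ cong (λ b → if b then f (i ℕ.* m) else 0ℚ) (divBool-yes m (i ℕ.* m) (ℕD.n∣m*n i)) ⟩
    f (i ℕ.* m) ∎

-- Appell sequences and Bernoulli polynomials

appell : (ℕ → ℚ) → ℕ → ℚ → ℚ
appell a n y = Σ< (suc n) (λ k → ι (n C k) ℚ.* (a k ℚ.* (y ^ (n ∸ k))))

appell-cong : ∀ {a b} n y → (∀ k → a k ≡ b k) → appell a n y ≡ appell b n y
appell-cong {a} {b} n y a≡b =
  Σ<-cong (suc n) (λ k _ → cong (λ t → ι (n C k) ℚ.* (t ℚ.* (y ^ (n ∸ k)))) (a≡b k))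

appell-linear : ∀ u a b n y → appell (λ k → u ℚ.* a k ℚ.+ b k) n y ≡ u ℚ.* appell a n y ℚ.+ appell b n y
appell-linear u a b n y = begin
  appell (λ k → u ℚ.* a k ℚ.+ b k) n y
    ≡⟨ Σ<-cong (suc n) (λ k _ → distrib (ι (n C k)) u (a k) (b k) (y ^ (n ∸ k))) ⟩
  Σ< (suc n) (λ k → u ℚ.* term a k ℚ.+ term b k)
    ≡⟨ Σ<-+ (suc n) _ _ ⟩
  Σ< (suc n) (λ k → u ℚ.* term a k) ℚ.+ appell b n y
    ≡⟨ cong (ℚ._+ appell b n y) (Σ<-*ˡ (suc n) u (term a)) ⟩
  u ℚ.* appell a n y ℚ.+ appell b n y ∎
  where
  open ≡-Reasoning
  term : (ℕ → ℚ) → ℕ → ℚ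
  term a k = ι (n C k) ℚ.* (a k ℚ.* (y ^ (n ∸ k)))
  distrib : ∀ c u x z w → c ℚ.* ((u ℚ.* x ℚ.+ z) ℚ.* w) ≡ u ℚ.* (c ℚ.* (x ℚ.* w)) ℚ.+ c ℚ.* (z ℚ.* w)
  distrib = solve 5 (λ c u x z w → c :* ((u :* x :+ z) :* w) := u :* (c :* (x :* w)) :+ c :* (z :* w)) refl

appell-0 : ∀ a y → appell a 0 y ≡ a 0
appell-0 a y = solve 1 (λ a → con 0ℚ :+ con 1ℚ :* (a :* con 1ℚ) := a) refl (a 0)

appell-suc : ∀ a n y → appell a (suc n) y ≡ y ℚ.* appell a n y ℚ.+ appell (λ k → a (suc k)) n y
appell-suc a n y = begin
  appell a (suc n) y
    ≡⟨ Σ<-suc (suc n) T ⟩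
  T 0 ℚ.+ Σ< (suc n) (λ k → T (suc k))
    ≡⟨ cong (T 0 ℚ.+_) (trans (Σ<-cong (suc n) (λ k _ → pascal k)) (Σ<-+ (suc n) U V)) ⟩
  T 0 ℚ.+ (Σ< (suc n) U ℚ.+ Σ< (suc n) V)
    ≡⟨ solve 3 (λ a b c → a :+ (b :+ c) := (a :+ c) :+ b) refl (T 0) (Σ< (suc n) U) (Σ< (suc n) V) ⟩
  (T 0 ℚ.+ Σ< (suc n) V) ℚ.+ appell (λ k → a (suc k)) n y
    ≡⟨ cong (ℚ._+ appell (λ k → a (suc k)) n y) lowered ⟩
  y ℚ.* appell a n y ℚ.+ appell (λ k → a (suc k)) n y ∎
  where
  open ≡-Reasoning
  T U V W : ℕ → ℚ
  T k = ι (suc n C k) ℚ.* (a k ℚ.* (y ^ (suc n ∸ k)))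
  U k = ι (n C k) ℚ.* (a (suc k) ℚ.* (y ^ (n ∸ k)))
  V k = ι (n C suc k) ℚ.* (a (suc k) ℚ.* (y ^ (n ∸ k)))
  W k = ι (n C k) ℚ.* (a k ℚ.* (y ^ (n ∸ k)))
  pascal : ∀ k → T (suc k) ≡ U k ℚ.+ V k
  pascal k rewrite sym (nCk+nC[k+1]≡[n+1]C[k+1] n k) | ι-+ (n C k) (n C suc k) =
    ℚP.*-distribʳ-+ (a (suc k) ℚ.* (y ^ (n ∸ k))) (ι (n C k)) (ι (n C suc k))
  V[n]≡0 : V n ≡ 0ℚ
  V[n]≡0 rewrite k>n⇒nCk≡0 {n} {suc n} ℕP.≤-refl = ℚP.*-zeroˡ (a (suc n) ℚ.* (y ^ (n ∸ n)))
  V≡y*W : ∀ k → k < n → V k ≡ y ℚ.* W (suc k)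
  V≡y*W k k<n rewrite ℕP.+-∸-assoc 1 k<n =
    solve 4 (λ c b y w → c :* (b :* (y :* w)) := y :* (c :* (b :* w))) refl (ι (n C suc k)) (a (suc k)) y (y ^ (n ∸ suc k))
  lowered : T 0 ℚ.+ Σ< (suc n) V ≡ y ℚ.* appell a n y
  lowered = begin
    T 0 ℚ.+ (Σ< n V ℚ.+ V n)                   ≡⟨ cong (λ t → T 0 ℚ.+ (Σ< n V ℚ.+ t)) V[n]≡0 ⟩
    T 0 ℚ.+ (Σ< n V ℚ.+ 0ℚ)                    ≡⟨ cong (T 0 ℚ.+_) (trans (ℚP.+-identityʳ _) (Σ<-cong n V≡y*W)) ⟩
    T 0 ℚ.+ Σ< n (λ k → y ℚ.* W (suc k))
      ≡⟨ cong (ℚ._+ Σ< n (λ k → y ℚ.* W (suc k)))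
           (solve 3 (λ a y w → con 1ℚ :* (a :* (y :* w)) := y :* (con 1ℚ :* (a :* w))) refl (a 0) y (y ^ n)) ⟩
    y ℚ.* W 0 ℚ.+ Σ< n (λ k → y ℚ.* W (suc k)) ≡⟨ Σ<-suc n (λ k → y ℚ.* W k) ⟨
    Σ< (suc n) (λ k → y ℚ.* W k)               ≡⟨ Σ<-*ˡ (suc n) y W ⟩
    y ℚ.* appell a n y                         ∎

appell-+ : ∀ n a y z → appell a n (y ℚ.+ z) ≡ appell (λ k → appell a k z) n y
appell-+ zero a y z = trans (appell-0 a (y ℚ.+ z)) (sym (trans (appell-0 (λ k → appell a k z) y) (appell-0 a z)))
appell-+ (suc n) a y z = begin
  appell a (suc n) (y ℚ.+ z)
    ≡⟨ appell-suc a n (y ℚ.+ z) ⟩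
  (y ℚ.+ z) ℚ.* appell a n (y ℚ.+ z) ℚ.+ appell a′ n (y ℚ.+ z)
    ≡⟨ cong₂ (λ s t → (y ℚ.+ z) ℚ.* s ℚ.+ t) (appell-+ n a y z) (appell-+ n a′ y z) ⟩
  (y ℚ.+ z) ℚ.* appell b n y ℚ.+ appell b′ n y
    ≡⟨ solve 4 (λ y z s t → (y :+ z) :* s :+ t := y :* s :+ (z :* s :+ t)) refl y z (appell b n y) (appell b′ n y) ⟩
  y ℚ.* appell b n y ℚ.+ (z ℚ.* appell b n y ℚ.+ appell b′ n y)
    ≡⟨ cong (y ℚ.* appell b n y ℚ.+_) (sym (appell-linear z b b′ n y)) ⟩
  y ℚ.* appell b n y ℚ.+ appell (λ k → z ℚ.* b k ℚ.+ b′ k) n y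
    ≡⟨ cong (y ℚ.* appell b n y ℚ.+_) (appell-cong n y (λ k → sym (appell-suc a k z))) ⟩
  y ℚ.* appell b n y ℚ.+ appell (λ k → b (suc k)) n y
    ≡⟨ appell-suc b n y ⟨
  appell b (suc n) y ∎
  where
  open ≡-Reasoning
  a′ b b′ : ℕ → ℚ
  a′ k = a (suc k)
  b k = appell a k z
  b′ k = appell a′ k z

δ₀ δ₁ : ℕ → ℚ
δ₀ zero    = 1ℚ
δ₀ (suc _) = 0ℚ
δ₁ zero    = 0ℚ
δ₁ (suc k) = δ₀ k

appell-δ₀ : ∀ n y → appell δ₀ n y ≡ y ^ n
appell-δ₀ zero    y = appell-0 δ₀ y
appell-δ₀ (suc n) y = begin
  appell δ₀ (suc n) y                              ≡⟨ appell-suc δ₀ n y ⟩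
  y ℚ.* appell δ₀ n y ℚ.+ appell (λ _ → 0ℚ) n y    ≡⟨ cong₂ (λ s t → y ℚ.* s ℚ.+ t) (appell-δ₀ n y) appell-zero ⟩
  y ℚ.* (y ^ n) ℚ.+ 0ℚ                             ≡⟨ ℚP.+-identityʳ (y ℚ.* (y ^ n)) ⟩
  y ^ suc n                                        ∎
  where
  open ≡-Reasoning
  appell-zero : appell (λ _ → 0ℚ) n y ≡ 0ℚ
  appell-zero = Σ<-zero (suc n) (λ k _ → solve 2 (λ c w → c :* (con 0ℚ :* w) := con 0ℚ) refl (ι (n C k)) (y ^ (n ∸ k)))

appell-δ₁ : ∀ n y → appell δ₁ (suc n) y ≡ ι (suc n) ℚ.* (y ^ n)
appell-δ₁ zero y = begin
  appell δ₁ 1 y                         ≡⟨ appell-suc δ₁ zero y ⟩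
  y ℚ.* appell δ₁ 0 y ℚ.+ appell δ₀ 0 y ≡⟨ cong₂ (λ s t → y ℚ.* s ℚ.+ t) (appell-0 δ₁ y) (appell-0 δ₀ y) ⟩
  y ℚ.* 0ℚ ℚ.+ 1ℚ                       ≡⟨ solve 1 (λ y → y :* con 0ℚ :+ con 1ℚ := con 1ℚ :* con 1ℚ) refl y ⟩
  1ℚ ℚ.* 1ℚ                             ∎
  where open ≡-Reasoning
appell-δ₁ (suc n) y = begin
  appell δ₁ (suc (suc n)) y
    ≡⟨ appell-suc δ₁ (suc n) y ⟩
  y ℚ.* appell δ₁ (suc n) y ℚ.+ appell δ₀ (suc n) y
    ≡⟨ cong₂ (λ s t → y ℚ.* s ℚ.+ t) (appell-δ₁ n y) (appell-δ₀ (suc n) y) ⟩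
  y ℚ.* (ι (suc n) ℚ.* (y ^ n)) ℚ.+ y ℚ.* (y ^ n)
    ≡⟨ solve 3 (λ y c w → y :* (c :* w) :+ y :* w := (c :+ con 1ℚ) :* (y :* w)) refl y (ι (suc n)) (y ^ n) ⟩
  (ι (suc n) ℚ.+ 1ℚ) ℚ.* (y ℚ.* (y ^ n))
    ≡⟨ cong (ℚ._* (y ℚ.* (y ^ n))) (sym (ι-suc (suc n))) ⟩
  ι (suc (suc n)) ℚ.* (y ^ suc n) ∎
  where open ≡-Reasoning

binomial : ∀ n y → (y ℚ.+ 1ℚ) ^ n ≡ appell (λ _ → 1ℚ) n y
binomial n y = begin
  (y ℚ.+ 1ℚ) ^ n                          ≡⟨ appell-δ₀ n (y ℚ.+ 1ℚ) ⟨
  appell δ₀ n (y ℚ.+ 1ℚ)                  ≡⟨ appell-+ n δ₀ y 1ℚ ⟩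
  appell (λ k → appell δ₀ k 1ℚ) n y       ≡⟨ appell-cong n y (λ k → trans (appell-δ₀ k 1ℚ) (^-zeroˡ k)) ⟩
  appell (λ _ → 1ℚ) n y                   ∎
  where open ≡-Reasoning

bernPoly≡appell : ∀ n x → bernPoly n x ≡ appell bernoulli n x
bernPoly≡appell n x = Σ₀≡Σ< n _

length-bernList : ∀ k → length (bernList k) ≡ k
length-bernList zero    = refl
length-bernList (suc k) rewrite ListP.length-++ (bernList k) {nextB k (bernList k) ∷ []} | length-bernList k =
  ℕP.+-comm k 1

foldr-zipWith-∷ʳ : ∀ (F : ℕ → ℚ → ℚ) is bs i b → length is ≡ length bs →
  foldr ℚ._+_ 0ℚ (zipWith F (is ++ i ∷ []) (bs ++ b ∷ [])) ≡ foldr ℚ._+_ 0ℚ (zipWith F is bs) ℚ.+ F i b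
foldr-zipWith-∷ʳ F []       []       i b _  = trans (ℚP.+-identityʳ (F i b)) (sym (ℚP.+-identityˡ (F i b)))
foldr-zipWith-∷ʳ F (x ∷ is) (y ∷ bs) i b eq rewrite foldr-zipWith-∷ʳ F is bs i b (ℕP.suc-injective eq) =
  sym (ℚP.+-assoc (F x y) _ (F i b))

bsum-bernList : ∀ N k → bsum N (bernList k) ≡ Σ< k (λ j → ι (N C j) ℚ.* bernoulli j)
bsum-bernList N k rewrite length-bernList k = go k
  where
  go : ∀ k → foldr ℚ._+_ 0ℚ (zipWith (λ j b → ι (N C j) ℚ.* b) (upTo k) (bernList k))
             ≡ Σ< k (λ j → ι (N C j) ℚ.* bernoulli j)
  go zero = refl
  go (suc k) rewrite sym (ListP.applyUpTo-∷ʳ (λ x → x) k)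
    | foldr-zipWith-∷ʳ (λ j b → ι (N C j) ℚ.* b) (upTo k) (bernList k) k (bernoulli k)
        (trans (ListP.length-upTo k) (sym (length-bernList k)))
    | go k = refl

bernPoly[1] : ∀ k → appell bernoulli k 1ℚ ≡ bernoulli k ℚ.+ δ₁ k
bernPoly[1] zero          = refl
bernPoly[1] (suc zero)    = refl
bernPoly[1] (suc (suc r)) = begin
  Σ< (suc k) F            ≡⟨ cong (ℚ._+ F k) (Σ<-cong k (λ j _ → F≡F′ j)) ⟩
  Σ< k F′ ℚ.+ F k         ≡⟨ cong₂ ℚ._+_ recurrence F[k]≡B[k] ⟩
  0ℚ ℚ.+ bernoulli k      ≡⟨ ℚP.+-comm 0ℚ (bernoulli k) ⟩
  bernoulli k ℚ.+ 0ℚ      ∎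
  where
  open ≡-Reasoning
  k = suc (suc r)
  F F′ : ℕ → ℚ
  F j = ι (k C j) ℚ.* (bernoulli j ℚ.* (1ℚ ^ (k ∸ j)))
  F′ j = ι (k C j) ℚ.* bernoulli j
  F≡F′ : ∀ j → F j ≡ F′ j
  F≡F′ j rewrite ^-zeroˡ (k ∸ j) = cong (ι (k C j) ℚ.*_) (ℚP.*-identityʳ (bernoulli j))
  F[k]≡B[k] : F k ≡ bernoulli k
  F[k]≡B[k] = trans (F≡F′ k) (trans (cong (λ t → ι t ℚ.* bernoulli k) (nCn≡1 k)) (ℚP.*-identityˡ (bernoulli k)))
  kC[k∸1]≡k : k C suc r ≡ k
  kC[k∸1]≡k = trans (nCk≡nC[n∸k] (ℕP.n≤1+n (suc r))) (trans (cong (k C_) (ℕP.m+n∸n≡m 1 (suc r))) (nC1≡n k))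
  X : ℚ
  X = bsum k (bernList (suc r))
  recurrence : Σ< k F′ ≡ 0ℚ
  recurrence = begin
    Σ< (suc r) F′ ℚ.+ F′ (suc r)                    ≡⟨ cong (ℚ._+ F′ (suc r)) (bsum-bernList k (suc r)) ⟨
    X ℚ.+ ι (k C suc r) ℚ.* (ℚ.- (recip k ℚ.* X))   ≡⟨ cong (λ t → X ℚ.+ ι t ℚ.* (ℚ.- (recip k ℚ.* X))) kC[k∸1]≡k ⟩
    X ℚ.+ ι k ℚ.* (ℚ.- (recip k ℚ.* X))             ≡⟨ solve 3 (λ x i r → x :+ i :* (:- (r :* x)) := x :- (i :* r) :* x)
                                                         refl X (ι k) (recip k) ⟩
    X ℚ.- (ι k ℚ.* recip k) ℚ.* X                   ≡⟨ cong (λ t → X ℚ.- t ℚ.* X) (ι*recip k) ⟩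
    X ℚ.- 1ℚ ℚ.* X                                  ≡⟨ solve 1 (λ x → x :- con 1ℚ :* x := con 0ℚ) refl X ⟩
    0ℚ                                              ∎

bernPoly-+1 : ∀ n y → bernPoly (suc n) (y ℚ.+ 1ℚ) ≡ bernPoly (suc n) y ℚ.+ ι (suc n) ℚ.* (y ^ n)
bernPoly-+1 n y = begin
  bernPoly (suc n) (y ℚ.+ 1ℚ)                            ≡⟨ bernPoly≡appell (suc n) (y ℚ.+ 1ℚ) ⟩
  appell bernoulli (suc n) (y ℚ.+ 1ℚ)                    ≡⟨ appell-+ (suc n) bernoulli y 1ℚ ⟩
  appell (λ k → appell bernoulli k 1ℚ) (suc n) y         ≡⟨ appell-cong (suc n) y B[1]≡ ⟩
  appell (λ k → 1ℚ ℚ.* bernoulli k ℚ.+ δ₁ k) (suc n) y   ≡⟨ appell-linear 1ℚ bernoulli δ₁ (suc n) y ⟩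
  1ℚ ℚ.* appell bernoulli (suc n) y ℚ.+ appell δ₁ (suc n) y
    ≡⟨ cong₂ ℚ._+_ (trans (ℚP.*-identityˡ _) (sym (bernPoly≡appell (suc n) y))) (appell-δ₁ n y) ⟩
  bernPoly (suc n) y ℚ.+ ι (suc n) ℚ.* (y ^ n)           ∎
  where
  open ≡-Reasoning
  B[1]≡ : ∀ k → appell bernoulli k 1ℚ ≡ 1ℚ ℚ.* bernoulli k ℚ.+ δ₁ k
  B[1]≡ k = trans (bernPoly[1] k) (cong (ℚ._+ δ₁ k) (sym (ℚP.*-identityˡ (bernoulli k))))

bernPoly-telescope : ∀ n c N →
  bernPoly (suc n) c ℚ.- bernPoly (suc n) (c ℚ.- ι N) ≡ Σ₁ N (λ i → ι (suc n) ℚ.* ((c ℚ.- ι i) ^ n))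
bernPoly-telescope n c zero =
  trans (cong (λ t → B c ℚ.- B t) (ℚP.+-identityʳ c)) (ℚP.+-inverseʳ (B c))
  where B = bernPoly (suc n)
bernPoly-telescope n c (suc N) = begin
  B c ℚ.- B y                         ≡⟨ solve 3 (λ a b t → a :- b := (a :- (b :+ t)) :+ t) refl (B c) (B y) T ⟩
  (B c ℚ.- (B y ℚ.+ T)) ℚ.+ T         ≡⟨ cong (λ u → (B c ℚ.- u) ℚ.+ T) (sym (bernPoly-+1 n y)) ⟩
  (B c ℚ.- B (y ℚ.+ 1ℚ)) ℚ.+ T        ≡⟨ cong (λ u → (B c ℚ.- B u) ℚ.+ T) y+1≡c-N ⟩
  (B c ℚ.- B (c ℚ.- ι N)) ℚ.+ T       ≡⟨ cong (ℚ._+ T) (bernPoly-telescope n c N) ⟩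
  Σ₁ N (λ i → ι (suc n) ℚ.* ((c ℚ.- ι i) ^ n)) ℚ.+ T ∎
  where
  open ≡-Reasoning
  B = bernPoly (suc n)
  y = c ℚ.- ι (suc N)
  T = ι (suc n) ℚ.* (y ^ n)
  y+1≡c-N : y ℚ.+ 1ℚ ≡ c ℚ.- ι N
  y+1≡c-N = trans (cong (λ t → (c ℚ.- t) ℚ.+ 1ℚ) (ι-suc N))
                  (solve 2 (λ c n → (c :- (n :+ con 1ℚ)) :+ con 1ℚ := c :- n) refl c (ι N))

-- Reduced fractions and fractional parts

+-def : ∀ x y → x ℚ.+ y ≡ (↥ x ℤ.* ↧ y ℤ.+ ↥ y ℤ.* ↧ x) / (↧ₙ x ℕ.* ↧ₙ y)
+-def (mkℚ _ _ _) (mkℚ _ _ _) = refl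

*-def : ∀ x y → x ℚ.* y ≡ (↥ x ℤ.* ↥ y) / (↧ₙ x ℕ.* ↧ₙ y)
*-def (mkℚ _ _ _) (mkℚ _ _ _) = refl

↧ₙ-neg : ∀ x → ↧ₙ (ℚ.- x) ≡ ↧ₙ x
↧ₙ-neg (mkℚ -[1+ _ ]    _ _) = refl
↧ₙ-neg (mkℚ (+ zero)    _ _) = refl
↧ₙ-neg (mkℚ (+ suc _)   _ _) = refl

∣↥∣-neg : ∀ x → ℤ.∣ ↥ (ℚ.- x) ∣ ≡ ℤ.∣ ↥ x ∣
∣↥∣-neg (mkℚ -[1+ _ ]   _ _) = refl
∣↥∣-neg (mkℚ (+ zero)   _ _) = refl
∣↥∣-neg (mkℚ (+ suc _)  _ _) = refl

∣↥/∣*gcd≡∣i∣ : ∀ i n .{{_ : NonZero n}} → ℤ.∣ ↥ (i / n) ∣ ℕ.* ℕG.gcd ℤ.∣ i ∣ n ≡ ℤ.∣ i ∣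
∣↥/∣*gcd≡∣i∣ i n = trans (sym (ℤP.abs-* (↥ (i / n)) (ℤG.gcd i (+ n)))) (cong ℤ.∣_∣ (ℚP.↥-/ i n))

↧ₙ/*gcd≡n : ∀ i n .{{_ : NonZero n}} → ↧ₙ (i / n) ℕ.* ℕG.gcd ℤ.∣ i ∣ n ≡ n
↧ₙ/*gcd≡n i n = trans (sym (ℤP.abs-* (↧ (i / n)) (ℤG.gcd i (+ n)))) (cong ℤ.∣_∣ (ℚP.↧-/ i n))

↧ₙ≢0 : ∀ x → NonZero (↧ₙ x)
↧ₙ≢0 (mkℚ _ _ _) = _

↧ₙ*↧ₙ≢0 : ∀ x y → NonZero (↧ₙ x ℕ.* ↧ₙ y)
↧ₙ*↧ₙ≢0 x y = ℕP.m*n≢0 (↧ₙ x) (↧ₙ y) {{↧ₙ≢0 x}} {{↧ₙ≢0 y}}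

truncate≡floor : ∀ y → ℚ.Positive y → ℚ.truncate y ≡ ℚ.floor y
truncate≡floor y y>0 with y ℚ.≤ᵇ 0ℚ in y≤ᵇ0
... | false = refl
... | true  = ⊥-elim (ℚP.<-irrefl refl
                      (ℚP.<-≤-trans (ℚP.positive⁻¹ y {{y>0}}) (ℚP.≤ᵇ⇒≤ (subst Bool.T (sym y≤ᵇ0) _))))

floor-nonNeg : ∀ y → .{{_ : ℚ.NonNegative y}} → ℚ.floor y ≡ + (ℤ.∣ ↥ y ∣ ℕ./ ↧ₙ y)
floor-nonNeg (mkℚ (+ a) d _) = div-pos-is-/ℕ (+ a) (suc d)

floor-/ : ∀ a m .{{_ : NonZero m}} → ℚ.floor ((+ a) / m) ≡ + (a ℕ./ m)
floor-/ a m@(suc _) = trans (floor-nonNeg y {{ℚP.normalize-nonNeg a m}}) (cong +_ ∣↥y∣/↧y≡a/m)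
  where
  y = (+ a) / m
  g = ℕG.gcd a m
  instance
    _ = ↧ₙ≢0 y
    _ : NonZero (↧ₙ y ℕ.* g)
    _ = subst NonZero (sym (↧ₙ/*gcd≡n (+ a) m)) _
  ∣↥y∣/↧y≡a/m : ℤ.∣ ↥ y ∣ ℕ./ ↧ₙ y ≡ a ℕ./ m
  ∣↥y∣/↧y≡a/m = begin
    ℤ.∣ ↥ y ∣ ℕ./ ↧ₙ y                      ≡⟨ m*n/o*n≡m/o (ℤ.∣ ↥ y ∣) g (↧ₙ y) ⟨
    (ℤ.∣ ↥ y ∣ ℕ.* g) ℕ./ (↧ₙ y ℕ.* g)      ≡⟨ cong (ℕ._/ (↧ₙ y ℕ.* g)) (∣↥/∣*gcd≡∣i∣ (+ a) m) ⟩
    a ℕ./ (↧ₙ y ℕ.* g)                      ≡⟨ /-congʳ (↧ₙ/*gcd≡n (+ a) m) ⟩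
    a ℕ./ m                                 ∎
    where open ≡-Reasoning

/-ι[/]≡[%]/ : ∀ a m .{{_ : NonZero m}} → (+ a) / m ℚ.- ι (a ℕ./ m) ≡ (+ (a ℕ.% m)) / m
/-ι[/]≡[%]/ a m@(suc m′) = begin
  (+ a) / m ℚ.- ι Q
    ≡⟨ cong (λ t → (+ t) / m ℚ.- ι Q) (m≡m%n+[m/n]*n a m) ⟩
  (+ (R ℕ.+ Q ℕ.* m)) / m ℚ.- ι Q
    ≡⟨ cong (ℚ._- ι Q) (/≡ι*recip (R ℕ.+ Q ℕ.* m) m′) ⟩
  ι (R ℕ.+ Q ℕ.* m) ℚ.* recip m ℚ.- ι Q
    ≡⟨ cong (λ t → t ℚ.* recip m ℚ.- ι Q) (trans (ι-+ R (Q ℕ.* m)) (cong (ι R ℚ.+_) (ι-* Q m))) ⟩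
  (ι R ℚ.+ ι Q ℚ.* ι m) ℚ.* recip m ℚ.- ι Q
    ≡⟨ solve 4 (λ r q m i → (r :+ q :* m) :* i :- q := r :* i :+ q :* (m :* i :- con 1ℚ)) refl (ι R) (ι Q) (ι m) (recip m) ⟩
  ι R ℚ.* recip m ℚ.+ ι Q ℚ.* (ι m ℚ.* recip m ℚ.- 1ℚ)
    ≡⟨ cong (λ t → ι R ℚ.* recip m ℚ.+ ι Q ℚ.* (t ℚ.- 1ℚ)) (ι*recip m) ⟩
  ι R ℚ.* recip m ℚ.+ ι Q ℚ.* (1ℚ ℚ.- 1ℚ)
    ≡⟨ solve 2 (λ x q → x :+ q :* (con 1ℚ :- con 1ℚ) := x) refl (ι R ℚ.* recip m) (ι Q) ⟩
  ι R ℚ.* recip m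
    ≡⟨ /≡ι*recip R m′ ⟨
  (+ R) / m ∎
  where
  open ≡-Reasoning
  Q = a ℕ./ m
  R = a ℕ.% m

fracPart-/ : ∀ a m .{{_ : NonZero a}} .{{_ : NonZero m}} → fracPart ((+ a) / m) ≡ (+ a) / m ℚ.- ι (a ℕ./ m)
fracPart-/ a m = begin
  fracPart y
    ≡⟨ fracPart-def y ⟩
  ℚ.∣ y ℚ.- (ℚ.truncate y) / 1 ∣
    ≡⟨ cong (λ t → ℚ.∣ y ℚ.- t / 1 ∣) (trans (truncate≡floor y (ℚP.normalize-pos a m)) (floor-/ a m)) ⟩
  ℚ.∣ y ℚ.- ι (a ℕ./ m) ∣
    ≡⟨ ℚP.0≤p⇒∣p∣≡p 0≤y-ι[a/m] ⟩
  y ℚ.- ι (a ℕ./ m) ∎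
  where
  open ≡-Reasoning
  y = (+ a) / m
  fracPart-def : ∀ y → fracPart y ≡ ℚ.∣ y ℚ.- (ℚ.truncate y) / 1 ∣
  fracPart-def (mkℚ _ _ _) = refl
  0≤y-ι[a/m] : 0ℚ ℚ.≤ y ℚ.- ι (a ℕ./ m)
  0≤y-ι[a/m] = subst (0ℚ ℚ.≤_) (sym (/-ι[/]≡[%]/ a m)) (ℚP.nonNegative⁻¹ _ {{ℚP.normalize-nonNeg (a ℕ.% m) m}})

∣[P∸l]-rP∣≡∣l-[1-r]P∣ : ∀ P r l → l ≤ P →
  ℤ.∣ + (P ∸ l) ℤ.- r ℤ.* + P ∣ ≡ ℤ.∣ + l ℤ.- (+ 1 ℤ.- r) ℤ.* + P ∣
∣[P∸l]-rP∣≡∣l-[1-r]P∣ P r l l≤P = begin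
  ℤ.∣ + (P ∸ l) ℤ.- r ℤ.* + P ∣              ≡⟨ cong (λ t → ℤ.∣ t ℤ.- r ℤ.* + P ∣) (sym (ℤP.⊖-≥ l≤P)) ⟩
  ℤ.∣ (P ℤ.⊖ l) ℤ.- r ℤ.* + P ∣              ≡⟨ cong (λ t → ℤ.∣ t ℤ.- r ℤ.* + P ∣) (sym (ℤP.m-n≡m⊖n P l)) ⟩
  ℤ.∣ (+ P ℤ.- + l) ℤ.- r ℤ.* + P ∣          ≡⟨ cong ℤ.∣_∣ (reflect (+ P) (+ l) r) ⟩
  ℤ.∣ ℤ.- (+ l ℤ.- (+ 1 ℤ.- r) ℤ.* + P) ∣    ≡⟨ ℤP.∣-i∣≡∣i∣ (+ l ℤ.- (+ 1 ℤ.- r) ℤ.* + P) ⟩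
  ℤ.∣ + l ℤ.- (+ 1 ℤ.- r) ℤ.* + P ∣          ∎
  where
  open ≡-Reasoning
  reflect : ∀ P l r → (P ℤ.- l) ℤ.- r ℤ.* P ≡ ℤ.- (l ℤ.- (+ 1 ℤ.- r) ℤ.* P)
  reflect = solve-∀

divBool-reflect : ∀ m P r l → l ≤ P →
  divBool m (+ (P ∸ l) ℤ.- r ℤ.* + P) ≡ divBool m (+ l ℤ.- (+ 1 ℤ.- r) ℤ.* + P)
divBool-reflect m P r l l≤P = cong (λ k → ⌊ m ∣? k ⌋) (∣[P∸l]-rP∣≡∣l-[1-r]P∣ P r l l≤P)

K≡K′ : ∀ p r m → K p r m ≡ K′ p r m
K≡K′ zero    r m = refl
K≡K′ (suc P) r m = trans (Σ₁-reverse P _) (Σ₁-cong P (λ l _ l≤P →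
  cong (λ b → if b then recip (suc P ∸ l) else 0ℚ) (divBool-reflect m (suc P) r l (ℕP.m≤n⇒m≤1+n l≤P))))

-- Congruences modulo p between p-integral rationals

module ModP (p : ℕ) (p-prime : Prime p) where

  instance
    p≢0 : NonZero p
    p≢0 = prime⇒nonZero p-prime

  1<p : 1 < p
  1<p = ℕ.nonTrivial⇒n>1 p {{prime⇒nonTrivial p-prime}}

  -- Records rather than the product CongModℚ (see ≈⇒CongModℚ), so that the rationals stay inferable.
  record Integral (x : ℚ) : Set where
    constructor integral
    field p∤↧ : ¬ p ∣ ↧ₙ x

  record Multiple (x : ℚ) : Set where
    constructor multiple
    field
      p∣↥       : p ∣ ℤ.∣ ↥ x ∣
      integral⁺ : Integral x
  open Multiple public using (integral⁺)

  infix 4 _≈_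
  record _≈_ (a b : ℚ) : Set where
    constructor ≈-intro
    field difference : Multiple (a ℚ.- b)
  open _≈_ public

  p∤* : ∀ {a b} → ¬ p ∣ a → ¬ p ∣ b → ¬ p ∣ a ℕ.* b
  p∤* p∤a p∤b p∣ab with euclidsLemma _ _ p-prime p∣ab
  ... | inj₁ p∣a = p∤a p∣a
  ... | inj₂ p∣b = p∤b p∣b

  p∤1 : ¬ p ∣ 1
  p∤1 = ℕD.>⇒∤ 1<p

  p∤0<n<p : ∀ {n} → 0 < n → n < p → ¬ p ∣ n
  p∤0<n<p 0<n n<p = ℕD.>⇒∤ {{ℕ.>-nonZero 0<n}} n<p

  p∤rp+l : ∀ r {l} → 0 < l → l < p → ¬ p ∣ r ℕ.* p ℕ.+ l
  p∤rp+l r 0<l l<p p∣rp+l = p∤0<n<p 0<l l<p (ℕD.∣m+n∣m⇒∣n p∣rp+l (ℕD.n∣m*n r))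

  integral-/ : ∀ i n .{{_ : NonZero n}} → ¬ p ∣ n → Integral (i / n)
  integral-/ i n p∤n = integral λ p∣↧ → p∤n (subst (p ∣_) (↧ₙ/*gcd≡n i n) (ℕD.∣m⇒∣m*n _ p∣↧))

  multiple-/ : ∀ i n .{{_ : NonZero n}} → p ∣ ℤ.∣ i ∣ → ¬ p ∣ n → Multiple (i / n)
  multiple-/ i n p∣i p∤n = multiple p∣↥ (integral-/ i n p∤n)
    where
    p∤gcd : ¬ p ∣ ℕG.gcd ℤ.∣ i ∣ n
    p∤gcd p∣g = p∤n (ℕD.∣-trans p∣g (ℕG.gcd[m,n]∣n ℤ.∣ i ∣ n))
    p∣↥ : p ∣ ℤ.∣ ↥ (i / n) ∣
    p∣↥ with euclidsLemma _ _ p-prime (subst (p ∣_) (sym (∣↥/∣*gcd≡∣i∣ i n)) p∣i)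
    ... | inj₁ p∣↥ = p∣↥
    ... | inj₂ p∣g = ⊥-elim (p∤gcd p∣g)

  integral-+ : ∀ {x y} → Integral x → Integral y → Integral (x ℚ.+ y)
  integral-+ {x} {y} (integral p∤x) (integral p∤y) rewrite +-def x y =
    integral-/ (↥ x ℤ.* ↧ y ℤ.+ ↥ y ℤ.* ↧ x) (↧ₙ x ℕ.* ↧ₙ y) {{↧ₙ*↧ₙ≢0 x y}} (p∤* p∤x p∤y)

  integral-* : ∀ {x y} → Integral x → Integral y → Integral (x ℚ.* y)
  integral-* {x} {y} (integral p∤x) (integral p∤y) rewrite *-def x y =
    integral-/ (↥ x ℤ.* ↥ y) (↧ₙ x ℕ.* ↧ₙ y) {{↧ₙ*↧ₙ≢0 x y}} (p∤* p∤x p∤y)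

  integral-neg : ∀ {x} → Integral x → Integral (ℚ.- x)
  integral-neg {x} (integral p∤x) = integral (subst (λ k → ¬ p ∣ k) (sym (↧ₙ-neg x)) p∤x)

  multiple-neg : ∀ {x} → Multiple x → Multiple (ℚ.- x)
  multiple-neg {x} (multiple p∣x ix) = multiple (subst (p ∣_) (sym (∣↥∣-neg x)) p∣x) (integral-neg ix)

  multiple-+ : ∀ {x y} → Multiple x → Multiple y → Multiple (x ℚ.+ y)
  multiple-+ {x} {y} (multiple p∣x (integral p∤x)) (multiple p∣y (integral p∤y)) rewrite +-def x y =
    multiple-/ (↥ x ℤ.* ↧ y ℤ.+ ↥ y ℤ.* ↧ x) (↧ₙ x ℕ.* ↧ₙ y) {{↧ₙ*↧ₙ≢0 x y}}
      (ℤD.∣⇒∣ᵤ {+ p} (ℤD.∣m∣n⇒∣m+n (ℤD.∣m⇒∣m*n (↧ y) (ℤD.∣ᵤ⇒∣ {+ p} {↥ x} p∣x))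
                                  (ℤD.∣m⇒∣m*n (↧ x) (ℤD.∣ᵤ⇒∣ {+ p} {↥ y} p∣y))))
      (p∤* p∤x p∤y)

  multiple-*ʳ : ∀ {x y} → Multiple x → Integral y → Multiple (x ℚ.* y)
  multiple-*ʳ {x} {y} (multiple p∣x (integral p∤x)) (integral p∤y) rewrite *-def x y =
    multiple-/ (↥ x ℤ.* ↥ y) (↧ₙ x ℕ.* ↧ₙ y) {{↧ₙ*↧ₙ≢0 x y}}
      (ℤD.∣⇒∣ᵤ {+ p} (ℤD.∣m⇒∣m*n (↥ y) (ℤD.∣ᵤ⇒∣ {+ p} {↥ x} p∣x))) (p∤* p∤x p∤y)

  multiple-*ˡ : ∀ {x y} → Integral x → Multiple y → Multiple (x ℚ.* y)
  multiple-*ˡ {x} {y} ix my = subst Multiple (ℚP.*-comm y x) (multiple-*ʳ my ix)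

  integral-ι : ∀ k → Integral (ι k)
  integral-ι k = integral-/ (+ k) 1 p∤1

  multiple-ι : ∀ k → p ∣ k → Multiple (ι k)
  multiple-ι k p∣k = multiple-/ (+ k) 1 p∣k p∤1

  integral-recip : ∀ k → ¬ p ∣ k → Integral (recip k)
  integral-recip zero    _   = integral-ι 0
  integral-recip (suc k) p∤k = integral-/ (+ 1) (suc k) p∤k

  integral-^ : ∀ {x} e → Integral x → Integral (x ^ e)
  integral-^ zero    _  = integral-ι 1
  integral-^ (suc e) ix = integral-* ix (integral-^ e ix)

  multiple-^ : ∀ {x} e .{{_ : NonZero e}} → Multiple x → Multiple (x ^ e)
  multiple-^ (suc e) mx = multiple-*ʳ mx (integral-^ e (integral⁺ mx))

  difference≡ : ∀ {a b x} → a ℚ.- b ≡ x → Multiple x → a ≈ b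
  difference≡ eq mx = ≈-intro (subst Multiple (sym eq) mx)

  ≈-reflexive : ∀ {a b} → a ≡ b → a ≈ b
  ≈-reflexive {a} refl = difference≡ (ℚP.+-inverseʳ a) (multiple-ι 0 (ℕD._∣0 p))

  ≈-refl : ∀ {a} → a ≈ a
  ≈-refl = ≈-reflexive refl

  ≈-sym : ∀ {a b} → a ≈ b → b ≈ a
  ≈-sym {a} {b} (≈-intro m) =
    difference≡ (solve 2 (λ a b → b :- a := :- (a :- b)) refl a b) (multiple-neg m)

  ≈-trans : ∀ {a b c} → a ≈ b → b ≈ c → a ≈ c
  ≈-trans {a} {b} {c} (≈-intro m) (≈-intro n) =
    difference≡ (solve 3 (λ a b c → a :- c := (a :- b) :+ (b :- c)) refl a b c) (multiple-+ m n)

  ≈-setoid : Setoid _ _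
  ≈-setoid = record
    { Carrier = ℚ ; _≈_ = _≈_
    ; isEquivalence = record { refl = ≈-refl ; sym = ≈-sym ; trans = ≈-trans } }

  open import Relation.Binary.Reasoning.Setoid ≈-setoid

  +-cong : ∀ {a b c d} → a ≈ b → c ≈ d → a ℚ.+ c ≈ b ℚ.+ d
  +-cong {a} {b} {c} {d} (≈-intro m) (≈-intro n) =
    difference≡ (solve 4 (λ a b c d → (a :+ c) :- (b :+ d) := (a :- b) :+ (c :- d)) refl a b c d) (multiple-+ m n)

  neg-cong : ∀ {a b} → a ≈ b → ℚ.- a ≈ ℚ.- b
  neg-cong {a} {b} (≈-intro m) =
    difference≡ (solve 2 (λ a b → (:- a) :- (:- b) := :- (a :- b)) refl a b) (multiple-neg m)

  *-congˡ : ∀ {a b} c → Integral c → a ≈ b → c ℚ.* a ≈ c ℚ.* b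
  *-congˡ {a} {b} c ic (≈-intro m) =
    difference≡ (solve 3 (λ a b c → c :* a :- c :* b := c :* (a :- b)) refl a b c) (multiple-*ˡ ic m)

  *-cong : ∀ {a b c d} → Integral a → Integral d → a ≈ b → c ≈ d → a ℚ.* c ≈ b ℚ.* d
  *-cong {a} {b} {c} {d} ia id (≈-intro m) (≈-intro n) =
    difference≡ (solve 4 (λ a b c d → a :* c :- b :* d := a :* (c :- d) :+ (a :- b) :* d) refl a b c d)
                (multiple-+ (multiple-*ˡ ia n) (multiple-*ʳ m id))

  ^-cong : ∀ {a b} e → Integral a → Integral b → a ≈ b → a ^ e ≈ b ^ e
  ^-cong zero    _  _  _   = ≈-refl
  ^-cong (suc e) ia ib a≈b = *-cong ia (integral-^ e ib) a≈b (^-cong e ia ib a≈b)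

  integral-resp-≈ : ∀ {a b} → a ≈ b → Integral b → Integral a
  integral-resp-≈ {a} {b} (≈-intro m) ib =
    subst Integral (solve 2 (λ a b → (a :- b) :+ b := a) refl a b) (integral-+ (integral⁺ m) ib)

  multiple⇒≈0 : ∀ {x} → Multiple x → x ≈ 0ℚ
  multiple⇒≈0 {x} = difference≡ (ℚP.+-identityʳ x)

  Σ₁-cong-≈ : ∀ n {f g} → (∀ k → 1 ≤ k → k ≤ n → f k ≈ g k) → Σ₁ n f ≈ Σ₁ n g
  Σ₁-cong-≈ zero    f≈g = ≈-refl
  Σ₁-cong-≈ (suc n) f≈g =
    +-cong (Σ₁-cong-≈ n (λ k 1≤k k≤n → f≈g k 1≤k (ℕP.m≤n⇒m≤1+n k≤n))) (f≈g (suc n) (s≤s z≤n) ℕP.≤-refl)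

  integral-Σ< : ∀ n {f} → (∀ k → k < n → Integral (f k)) → Integral (Σ< n f)
  integral-Σ< zero    _  = integral-ι 0
  integral-Σ< (suc n) if = integral-+ (integral-Σ< n (λ k k<n → if k (ℕP.m<n⇒m<1+n k<n))) (if n ℕP.≤-refl)

  multiple-Σ< : ∀ n {f} → (∀ k → k < n → Multiple (f k)) → Multiple (Σ< n f)
  multiple-Σ< zero    _  = multiple-ι 0 (ℕD._∣0 p)
  multiple-Σ< (suc n) mf = multiple-+ (multiple-Σ< n (λ k k<n → mf k (ℕP.m<n⇒m<1+n k<n))) (mf n ℕP.≤-refl)

  multiple[a+b]⇒a≈-b : ∀ {a b} → Multiple (a ℚ.+ b) → a ≈ ℚ.- b
  multiple[a+b]⇒a≈-b {a} {b} = difference≡ (solve 2 (λ a b → a :- (:- b) := a :+ b) refl a b)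

  recip≈-recip : ∀ a b → ¬ p ∣ a → ¬ p ∣ b → p ∣ a ℕ.+ b → recip a ≈ ℚ.- recip b
  recip≈-recip zero      _         p∤a _   _     = ⊥-elim (p∤a (ℕD._∣0 p))
  recip≈-recip (suc _)   zero      _   p∤b _     = ⊥-elim (p∤b (ℕD._∣0 p))
  recip≈-recip a@(suc _) b@(suc _) p∤a p∤b p∣a+b =
    multiple[a+b]⇒a≈-b (subst Multiple (sym (recip+recip≡recip*recip*ι[+] a b))
      (multiple-*ˡ (integral-* (integral-recip a p∤a) (integral-recip b p∤b)) (multiple-ι (a ℕ.+ b) p∣a+b)))

  p∤k! : ∀ k → k < p → ¬ p ∣ k !
  p∤k! zero    _   = p∤1
  p∤k! (suc k) k<p = p∤* (p∤0<n<p (s≤s z≤n) k<p) (p∤k! k (ℕP.<-trans (ℕP.n<1+n k) k<p))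

  p∣pCk : ∀ k → 0 < k → k < p → p ∣ p C k
  p∣pCk k 0<k k<p with euclidsLemma (p C k) D p-prime (subst (p ∣_) (sym pCk*D≡p!) (n∣n! p))
    where
    D = k ! ℕ.* (p ∸ k) !
    instance _ = ℕP._!*_!≢0 k (p ∸ k)
    pCk*D≡p! : (p C k) ℕ.* D ≡ p !
    pCk*D≡p! = trans (cong (ℕ._* D) (nCk≡n!/k![n-k]! (ℕP.<⇒≤ k<p))) (m/n*n≡m (k![n∸k]!∣n! (ℕP.<⇒≤ k<p)))
  ... | inj₁ p∣pCk = p∣pCk
  ... | inj₂ p∣D   = ⊥-elim (p∤* (p∤k! k k<p) (p∤k! (p ∸ k) (ℕP.∸-monoʳ-< {o = 0} 0<k (ℕP.<⇒≤ k<p))) p∣D)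

  Σ<-≈-ends : ∀ n .{{_ : NonZero n}} {f} → (∀ k → 0 < k → k < n → Multiple (f k)) → Σ< (suc n) f ≈ f 0 ℚ.+ f n
  Σ<-≈-ends (suc n) {f} mf = begin
    Σ< (suc n) f ℚ.+ f (suc n)                              ≡⟨ cong (ℚ._+ f (suc n)) (Σ<-suc n f) ⟩
    (f 0 ℚ.+ Σ< n (λ k → f (suc k))) ℚ.+ f (suc n)          ≈⟨ +-cong (+-cong (≈-refl {f 0}) inner≈0) (≈-refl {f (suc n)}) ⟩
    (f 0 ℚ.+ 0ℚ) ℚ.+ f (suc n)                              ≡⟨ cong (ℚ._+ f (suc n)) (ℚP.+-identityʳ (f 0)) ⟩
    f 0 ℚ.+ f (suc n)                                       ∎
    where
    inner≈0 : Σ< n (λ k → f (suc k)) ≈ 0ℚ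
    inner≈0 = multiple⇒≈0 (multiple-Σ< n (λ k k<n → mf (suc k) (s≤s z≤n) (s≤s k<n)))

  freshman : ∀ {y} → Integral y → (y ℚ.+ 1ℚ) ^ p ≈ y ^ p ℚ.+ 1ℚ
  freshman {y} iy = begin
    (y ℚ.+ 1ℚ) ^ p            ≡⟨ binomial p y ⟩
    Σ< (suc p) G              ≈⟨ Σ<-≈-ends p middle ⟩
    G 0 ℚ.+ G p               ≡⟨ cong₂ ℚ._+_ G[0]≡y^p G[p]≡1 ⟩
    y ^ p ℚ.+ 1ℚ              ∎
    where
    G : ℕ → ℚ
    G k = ι (p C k) ℚ.* (1ℚ ℚ.* (y ^ (p ∸ k)))
    G[0]≡y^p : G 0 ≡ y ^ p
    G[0]≡y^p = solve 1 (λ w → con 1ℚ :* (con 1ℚ :* w) := w) refl (y ^ p)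
    G[p]≡1 : G p ≡ 1ℚ
    G[p]≡1 rewrite nCn≡1 p | ℕP.n∸n≡0 p = refl
    middle : ∀ k → 0 < k → k < p → Multiple (G k)
    middle k 0<k k<p = multiple-*ʳ (multiple-ι _ (p∣pCk k 0<k k<p)) (integral-* (integral-ι 1) (integral-^ (p ∸ k) iy))

  fermat : ∀ a → ι a ^ p ≈ ι a
  fermat zero    = ≈-reflexive (trans (cong (0ℚ ^_) (sym (ℕP.suc-pred p))) (ℚP.*-zeroˡ (0ℚ ^ (p ∸ 1))))
  fermat (suc a) = begin
    ι (suc a) ^ p          ≡⟨ cong (_^ p) (ι-suc a) ⟩
    (ι a ℚ.+ 1ℚ) ^ p       ≈⟨ freshman (integral-ι a) ⟩
    ι a ^ p ℚ.+ 1ℚ         ≈⟨ +-cong (fermat a) ≈-refl ⟩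
    ι a ℚ.+ 1ℚ             ≡⟨ ι-suc a ⟨
    ι (suc a)              ∎

  fermat-inverse : ∀ i → ¬ p ∣ i → ι i ^ (p ∸ 2) ≈ recip i
  fermat-inverse zero    p∤0 = ⊥-elim (p∤0 (ℕD._∣0 p))
  fermat-inverse i@(suc _) p∤i = begin
    x ^ q                              ≡⟨ recip*[recip*ι^[2+q]]≡ι^q i q ⟨
    r ℚ.* (r ℚ.* (x ^ (2 ℕ.+ q)))      ≡⟨ cong (λ e → r ℚ.* (r ℚ.* (x ^ e))) 2+q≡p ⟩
    r ℚ.* (r ℚ.* (x ^ p))              ≈⟨ *-congˡ r ir (*-congˡ r ir (fermat i)) ⟩
    r ℚ.* (r ℚ.* x)                    ≡⟨ cong (r ℚ.*_) (recip*ι i) ⟩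
    r ℚ.* 1ℚ                           ≡⟨ ℚP.*-identityʳ r ⟩
    r                                  ∎
    where
    x = ι i
    r = recip i
    q = p ∸ 2
    ir : Integral r
    ir = integral-recip i p∤i
    2+q≡p : 2 ℕ.+ q ≡ p
    2+q≡p = ℕP.m+[n∸m]≡n 1<p

  integral-bernoulli : ∀ k → suc k < p → Integral (bernoulli k)
  integral-bernoulli k k+1<p = integral-bernoulli≤ k k+1<p k ℕP.≤-refl
    where
    integral-bernoulli≤ : ∀ k → suc k < p → ∀ j → j ≤ k → Integral (bernoulli j)
    integral-bernoulli≤ zero    _       zero _ = integral-ι 1
    integral-bernoulli≤ (suc k) k+2<p j j≤k+1 with ℕP.m≤n⇒m<n∨m≡n j≤k+1
    ... | inj₁ j<k+1 = integral-bernoulli≤ k (ℕP.<-trans (ℕP.n<1+n (suc k)) k+2<p) j (ℕP.≤-pred j<k+1)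
    ... | inj₂ refl  =
      integral-neg (integral-* (integral-recip (suc (suc k)) (p∤0<n<p (s≤s z≤n) k+2<p))
        (subst Integral (sym (bsum-bernList (suc (suc k)) (suc k)))
          (integral-Σ< (suc k) (λ i i≤k → integral-* (integral-ι (suc (suc k) C i))
            (integral-bernoulli≤ k (ℕP.<-trans (ℕP.n<1+n (suc k)) k+2<p) i (ℕP.≤-pred i≤k))))))

  bernPoly≈bernoulli : ∀ n {c} → n < p → Multiple c → bernPoly n c ≈ bernoulli n
  bernPoly≈bernoulli n {c} n<p mc = begin
    bernPoly n c                   ≡⟨ bernPoly≡appell n c ⟩
    Σ< n T ℚ.+ T n                 ≈⟨ +-cong (multiple⇒≈0 (multiple-Σ< n lower)) (≈-refl {T n}) ⟩
    0ℚ ℚ.+ T n                     ≡⟨ ℚP.+-identityˡ (T n) ⟩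
    T n                            ≡⟨ T[n]≡B[n] ⟩
    bernoulli n                    ∎
    where
    T : ℕ → ℚ
    T k = ι (n C k) ℚ.* (bernoulli k ℚ.* (c ^ (n ∸ k)))
    T[n]≡B[n] : T n ≡ bernoulli n
    T[n]≡B[n] rewrite nCn≡1 n | ℕP.n∸n≡0 n = solve 1 (λ b → con 1ℚ :* (b :* con 1ℚ) := b) refl (bernoulli n)
    lower : ∀ k → k < n → Multiple (T k)
    lower k k<n = multiple-*ˡ (integral-ι (n C k))
      (multiple-*ˡ (integral-bernoulli k (ℕP.≤-<-trans k<n n<p))
        (multiple-^ (n ∸ k) {{ℕ.>-nonZero (ℕP.m<n⇒0<n∸m k<n)}} mc))

  ι[[p∸1]*i]≈-ι[i] : ∀ i → ι ((p ∸ 1) ℕ.* i) ≈ ℚ.- ι i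
  ι[[p∸1]*i]≈-ι[i] i = multiple[a+b]⇒a≈-b (subst Multiple ι[p*i]≡ι[[p∸1]*i]+ι[i] (multiple-ι (p ℕ.* i) (ℕD.m∣m*n i)))
    where
    ι[p*i]≡ι[[p∸1]*i]+ι[i] : ι (p ℕ.* i) ≡ ι ((p ∸ 1) ℕ.* i) ℚ.+ ι i
    ι[p*i]≡ι[[p∸1]*i]+ι[i] = trans (cong ι (sym ([n∸1]*m+m≡n*m p i))) (ι-+ ((p ∸ 1) ℕ.* i) i)

  ≈⇒CongModℚ : ∀ {a b} → a ≈ b → CongModℚ p a b
  ≈⇒CongModℚ (≈-intro (multiple p∣↥ (integral p∤↧))) = p∣↥ , p∤↧

  if-≈ : ∀ b {x y} → x ≈ ℚ.- y → (if b then x else 0ℚ) ≈ ℚ.- (if b then y else 0ℚ)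
  if-≈ true  x≈-y = x≈-y
  if-≈ false _    = ≈-refl

  l≤p∸1⇒l<p : ∀ {l} → l ≤ p ∸ 1 → l < p
  l≤p∸1⇒l<p {l} l≤p-1 = subst (l <_) (ℕP.suc-pred p) (s≤s l≤p-1)

  recip[p∸l]≈-recip[rp+l] : ∀ r {l} → 0 < l → l < p → recip (p ∸ l) ≈ ℚ.- recip (r ℕ.* p ℕ.+ l)
  recip[p∸l]≈-recip[rp+l] r {l} 0<l l<p = recip≈-recip (p ∸ l) (r ℕ.* p ℕ.+ l) p∤p∸l (p∤rp+l r 0<l l<p) p∣sum
    where
    p∤p∸l : ¬ p ∣ p ∸ l
    p∤p∸l = p∤0<n<p (ℕP.m<n⇒0<n∸m l<p) (ℕP.∸-monoʳ-< {o = 0} 0<l (ℕP.<⇒≤ l<p))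
    p∣sum : p ∣ p ∸ l ℕ.+ (r ℕ.* p ℕ.+ l)
    p∣sum = subst (p ∣_) (sym (m∸n+[o+n]≡m+o (ℕP.<⇒≤ l<p) (r ℕ.* p))) (ℕD.∣m∣n⇒∣m+n ℕD.∣-refl (ℕD.n∣m*n r))

  K≈-K[1-r] : ∀ r m → K p r m ≈ ℚ.- K p (+ 1 ℤ.- r) m
  K≈-K[1-r] r m = begin
    K p r m
      ≡⟨ K≡K′ p r m ⟩
    K′ p r m
      ≈⟨ Σ₁-cong-≈ (p ∸ 1) (λ l 0<l l≤p-1 → if-≈ (b l) (recip[p∸l]≈-recip[rp+l] 0 0<l (l≤p∸1⇒l<p l≤p-1))) ⟩
    Σ₁ (p ∸ 1) (λ l → ℚ.- (if b l then recip l else 0ℚ))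
      ≡⟨ Σ₁-neg (p ∸ 1) _ ⟩
    ℚ.- K p (+ 1 ℤ.- r) m ∎
    where
    b : ℕ → Bool
    b l = divBool m (+ l ℤ.- (+ 1 ℤ.- r) ℤ.* + p)

  recipUnit : ℕ → ℚ
  recipUnit k = if divBool p (+ k) then 0ℚ else recip k

  K[1+r]≈-Σ₁block : ∀ m r → K p (+ suc r) m ≈ ℚ.- Σ₁ p (λ v → onMultiplesOf m recipUnit (r ℕ.* p ℕ.+ v))
  K[1+r]≈-Σ₁block m r = begin
    K p (+ suc r) m                       ≡⟨ K≡K′ p (+ suc r) m ⟩
    K′ p (+ suc r) m                      ≈⟨ Σ₁-cong-≈ (p ∸ 1) term ⟩
    Σ₁ (p ∸ 1) (λ v → ℚ.- F v)            ≡⟨ Σ₁-neg (p ∸ 1) F ⟩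
    ℚ.- Σ₁ (p ∸ 1) F                      ≡⟨ cong ℚ.-_ (ℚP.+-identityʳ _) ⟨
    ℚ.- (Σ₁ (p ∸ 1) F ℚ.+ 0ℚ)             ≡⟨ cong (λ t → ℚ.- (Σ₁ (p ∸ 1) F ℚ.+ t)) F[p]≡0 ⟨
    ℚ.- (Σ₁ (p ∸ 1) F ℚ.+ F p)            ≡⟨ cong ℚ.-_ (Σ₁-last p F) ⟨
    ℚ.- Σ₁ p F                            ∎
    where
    F : ℕ → ℚ
    F v = onMultiplesOf m recipUnit (r ℕ.* p ℕ.+ v)
    F[p]≡0 : F p ≡ 0ℚ
    F[p]≡0 rewrite divBool-yes p (r ℕ.* p ℕ.+ p) (ℕD.∣m∣n⇒∣m+n (ℕD.n∣m*n r) ℕD.∣-refl) =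
      if-then-0-else-0 (divBool m (+ (r ℕ.* p ℕ.+ p)))
    l-[1-[1+r]]p≡rp+l : ∀ l → + l ℤ.- (+ 1 ℤ.- + suc r) ℤ.* + p ≡ + (r ℕ.* p ℕ.+ l)
    l-[1-[1+r]]p≡rp+l l = trans (shift (+ l) (+ r) (+ p)) (sym (trans (ℤP.pos-+ (r ℕ.* p) l) (cong (ℤ._+ + l) (ℤP.pos-* r p))))
      where
      shift : ∀ l r P → l ℤ.- (+ 1 ℤ.- (+ 1 ℤ.+ r)) ℤ.* P ≡ r ℤ.* P ℤ.+ l
      shift = solve-∀
    term : ∀ l → 1 ≤ l → l ≤ p ∸ 1 →
      (if divBool m (+ l ℤ.- (+ 1 ℤ.- + suc r) ℤ.* + p) then recip (p ∸ l) else 0ℚ) ≈ ℚ.- F l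
    term l 0<l l≤p-1 rewrite l-[1-[1+r]]p≡rp+l l =
      if-≈ (divBool m (+ u)) (subst (λ t → recip (p ∸ l) ≈ ℚ.- t) (sym recipUnit[u]≡recip[u])
        (recip[p∸l]≈-recip[rp+l] r 0<l l<p))
      where
      u = r ℕ.* p ℕ.+ l
      l<p = l≤p∸1⇒l<p l≤p-1
      recipUnit[u]≡recip[u] : recipUnit u ≡ recip u
      recipUnit[u]≡recip[u] rewrite divBool-no p u (p∤rp+l r 0<l l<p) = refl

  ΣK≈-Σ₁onMultiplesOf : ∀ m n → Σ₁ n (λ r → K p (+ r) m) ≈ ℚ.- Σ₁ (n ℕ.* p) (onMultiplesOf m recipUnit)
  ΣK≈-Σ₁onMultiplesOf m n = begin
    Σ₁ n (λ r → K p (+ r) m)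
      ≈⟨ Σ₁-cong-≈ n (λ { (suc r) _ _ → K[1+r]≈-Σ₁block m r }) ⟩
    Σ₁ n (λ r → ℚ.- Σ₁ p (λ v → G ((r ∸ 1) ℕ.* p ℕ.+ v)))
      ≡⟨ Σ₁-neg n _ ⟩
    ℚ.- Σ₁ n (λ r → Σ₁ p (λ v → G ((r ∸ 1) ℕ.* p ℕ.+ v)))
      ≡⟨ cong ℚ.-_ (Σ₁-blocks p n G) ⟨
    ℚ.- Σ₁ (n ℕ.* p) G ∎
    where G = onMultiplesOf m recipUnit

  ι[m]*recipUnit[i*m]≡recipUnit[i] : ∀ m .{{_ : NonZero m}} → ¬ p ∣ m → ∀ i →
    ι m ℚ.* recipUnit (i ℕ.* m) ≡ recipUnit i
  ι[m]*recipUnit[i*m]≡recipUnit[i] m p∤m zero rewrite if-then-0-else-0 (divBool p (+ 0)) = ℚP.*-zeroʳ (ι m)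
  ι[m]*recipUnit[i*m]≡recipUnit[i] m p∤m i@(suc _) with p ∣? i
  ... | yes p∣i rewrite divBool-yes p (i ℕ.* m) (ℕD.∣m⇒∣m*n m p∣i) = ℚP.*-zeroʳ (ι m)
  ... | no  p∤i rewrite divBool-no p (i ℕ.* m) (p∤* p∤i p∤m) = ι[m]*recip[i*m]≡recip[i] i m

  ι[m]*ΣK≈-ΣrecipUnit : ∀ m .{{_ : NonZero m}} → ¬ p ∣ m → ∀ n →
    ι m ℚ.* Σ₁ n (λ r → K p (+ r) m) ≈ ℚ.- Σ₁ ((p ℕ.* n) ℕ./ m) recipUnit
  ι[m]*ΣK≈-ΣrecipUnit m p∤m n = begin
    ι m ℚ.* Σ₁ n (λ r → K p (+ r) m)
      ≈⟨ *-congˡ (ι m) (integral-ι m) (ΣK≈-Σ₁onMultiplesOf m n) ⟩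
    ι m ℚ.* ℚ.- Σ₁ (n ℕ.* p) (onMultiplesOf m recipUnit)
      ≡⟨ cong (λ k → ι m ℚ.* ℚ.- Σ₁ k (onMultiplesOf m recipUnit)) (ℕP.*-comm n p) ⟩
    ι m ℚ.* ℚ.- Σ₁ (p ℕ.* n) (onMultiplesOf m recipUnit)
      ≡⟨ cong (λ t → ι m ℚ.* ℚ.- t) (Σ₁-onMultiplesOf m (p ℕ.* n) recipUnit) ⟩
    ι m ℚ.* ℚ.- Σ₁ N (λ i → recipUnit (i ℕ.* m))
      ≡⟨ ℚP.neg-distribʳ-* (ι m) _ ⟨
    ℚ.- (ι m ℚ.* Σ₁ N (λ i → recipUnit (i ℕ.* m)))
      ≡⟨ cong ℚ.-_ (Σ₁-*ˡ N (ι m) _) ⟨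
    ℚ.- Σ₁ N (λ i → ι m ℚ.* recipUnit (i ℕ.* m))
      ≡⟨ cong ℚ.-_ (Σ₁-cong N (λ i _ _ → ι[m]*recipUnit[i*m]≡recipUnit[i] m p∤m i)) ⟩
    ℚ.- Σ₁ N recipUnit ∎
    where N = (p ℕ.* n) ℕ./ m

  p∸1≡1+[p∸2] : p ∸ 1 ≡ suc (p ∸ 2)
  p∸1≡1+[p∸2] = ℕP.+-∸-assoc 1 1<p

  ι[p∸1]≈-1 : ι (p ∸ 1) ≈ ℚ.- 1ℚ
  ι[p∸1]≈-1 = subst (λ k → ι k ≈ ℚ.- 1ℚ) (ℕP.*-identityʳ (p ∸ 1)) (ι[[p∸1]*i]≈-ι[i] 1)

  -- For p ∤ i, −i ≡ (p−1)i is a natural number, so Fermat's little theorem applies to it directly.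
  -- For p ∣ i the term vanishes because p − 2 ≥ 1: this is where p ≠ 2 is needed.
  ι[p∸1]*[c-i]^[p∸2]≈recipUnit : ∀ {c} → Multiple c → .{{_ : NonZero (p ∸ 2)}} → ∀ i →
    ι (p ∸ 1) ℚ.* ((c ℚ.- ι i) ^ (p ∸ 2)) ≈ recipUnit i
  ι[p∸1]*[c-i]^[p∸2]≈recipUnit {c} mc i with p ∣? i
  ... | yes p∣i = multiple⇒≈0 (multiple-*ˡ (integral-ι (p ∸ 1))
                    (multiple-^ (p ∸ 2) (multiple-+ mc (multiple-neg (multiple-ι i p∣i)))))
  ... | no p∤i = begin
    ι (p ∸ 1) ℚ.* ((c ℚ.- ι i) ^ (p ∸ 2))
      ≈⟨ *-congˡ (ι (p ∸ 1)) (integral-ι (p ∸ 1))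
           (^-cong (p ∸ 2) (integral-resp-≈ c-i≈j (integral-ι j)) (integral-ι j) c-i≈j) ⟩
    ι (p ∸ 1) ℚ.* (ι j ^ (p ∸ 2))
      ≈⟨ *-congˡ (ι (p ∸ 1)) (integral-ι (p ∸ 1)) (fermat-inverse j p∤j) ⟩
    ι (p ∸ 1) ℚ.* recip j
      ≈⟨ *-cong (integral-ι (p ∸ 1)) (integral-neg (integral-recip i p∤i))
           ι[p∸1]≈-1 (recip≈-recip j i p∤j p∤i p∣j+i) ⟩
    ℚ.- 1ℚ ℚ.* ℚ.- recip i
      ≡⟨ solve 1 (λ x → (:- con 1ℚ) :* (:- x) := x) refl (recip i) ⟩
    recip i ∎
    where
    j = (p ∸ 1) ℕ.* i
    p∤j : ¬ p ∣ j
    p∤j = p∤* (p∤0<n<p (ℕP.m<n⇒0<n∸m 1<p) (l≤p∸1⇒l<p ℕP.≤-refl)) p∤i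
    p∣j+i : p ∣ j ℕ.+ i
    p∣j+i = subst (p ∣_) (sym ([n∸1]*m+m≡n*m p i)) (ℕD.m∣m*n i)
    c-i≈j : c ℚ.- ι i ≈ ι j
    c-i≈j = begin
      c ℚ.- ι i            ≈⟨ +-cong (multiple⇒≈0 mc) (≈-refl {ℚ.- ι i}) ⟩
      0ℚ ℚ.- ι i           ≡⟨ ℚP.+-identityˡ (ℚ.- ι i) ⟩
      ℚ.- ι i              ≈⟨ ι[[p∸1]*i]≈-ι[i] i ⟨
      ι j                  ∎

  bernPoly-telescopeₚ : ∀ c N →
    bernPoly (p ∸ 1) c ℚ.- bernPoly (p ∸ 1) (c ℚ.- ι N) ≡ Σ₁ N (λ i → ι (p ∸ 1) ℚ.* ((c ℚ.- ι i) ^ (p ∸ 2)))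
  bernPoly-telescopeₚ c N rewrite p∸1≡1+[p∸2] = bernPoly-telescope (p ∸ 2) c N

  bernPoly[c-N]-B≈-ΣrecipUnit : ∀ {c} → Multiple c → .{{_ : NonZero (p ∸ 2)}} → ∀ N →
    bernPoly (p ∸ 1) (c ℚ.- ι N) ℚ.- bernoulli (p ∸ 1) ≈ ℚ.- Σ₁ N recipUnit
  bernPoly[c-N]-B≈-ΣrecipUnit {c} mc N = begin
    X ℚ.- bernoulli (p ∸ 1)
      ≈⟨ +-cong (≈-refl {X}) (neg-cong (bernPoly≈bernoulli (p ∸ 1) (l≤p∸1⇒l<p ℕP.≤-refl) mc)) ⟨
    X ℚ.- A
      ≡⟨ solve 2 (λ x a → x :- a := :- (a :- x)) refl X A ⟩
    ℚ.- (A ℚ.- X)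
      ≡⟨ cong ℚ.-_ (bernPoly-telescopeₚ c N) ⟩
    ℚ.- Σ₁ N (λ i → ι (p ∸ 1) ℚ.* ((c ℚ.- ι i) ^ (p ∸ 2)))
      ≈⟨ neg-cong (Σ₁-cong-≈ N (λ i _ _ → ι[p∸1]*[c-i]^[p∸2]≈recipUnit mc i)) ⟩
    ℚ.- Σ₁ N recipUnit ∎
    where
    A = bernPoly (p ∸ 1) c
    X = bernPoly (p ∸ 1) (c ℚ.- ι N)

corollary2p1 : (m n p : ℕ) → .{{_ : NonZero m}} → .{{_ : NonZero n}} →
    Prime p → p ≢ 2 → ¬ (p ∣ m) →
    ((r : ℤ) → (K p r m ≡ K′ p r m) × CongModℚ p (K p r m) (ℚ.- K p ((+ 1) ℤ.- r) m))
    × (CongModℚ p (bernPoly (p ∸ 1) (fracPart ((+ (p ℕ.* n)) ℚ./ m)) ℚ.- bernoulli (p ∸ 1))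
          (ι m ℚ.* Σ₁ n (λ r → K p (+ r) m))
       × CongModℚ p (ι m ℚ.* Σ₁ n (λ r → K p (+ r) m))
          (ℚ.- Σ₁ ((p ℕ.* n) ℕ./ m) (λ k → if divBool p (+ k) then 0ℚ else recip k)))
corollary2p1 m n p p-prime p≢2 p∤m =
    (λ r → K≡K′ p r m , ≈⇒CongModℚ (K≈-K[1-r] r m))
  , ≈⇒CongModℚ bernoulli-side
  , ≈⇒CongModℚ (ι[m]*ΣK≈-ΣrecipUnit m p∤m n)
  where
  open ModP p p-prime
  open import Relation.Binary.Reasoning.Setoid ≈-setoid
  instance
    p*n≢0 : NonZero (p ℕ.* n)
    p*n≢0 = ℕP.m*n≢0 p n
    p∸2≢0 : NonZero (p ∸ 2)
    p∸2≢0 = p≢2⇒p∸2≢0 p-prime p≢2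
  c = (+ (p ℕ.* n)) / m
  N = (p ℕ.* n) ℕ./ m
  bernoulli-side : bernPoly (p ∸ 1) (fracPart c) ℚ.- bernoulli (p ∸ 1) ≈ ι m ℚ.* Σ₁ n (λ r → K p (+ r) m)
  bernoulli-side = begin
    bernPoly (p ∸ 1) (fracPart c) ℚ.- bernoulli (p ∸ 1)
      ≡⟨ cong (λ x → bernPoly (p ∸ 1) x ℚ.- bernoulli (p ∸ 1)) (fracPart-/ (p ℕ.* n) m) ⟩
    bernPoly (p ∸ 1) (c ℚ.- ι N) ℚ.- bernoulli (p ∸ 1)
      ≈⟨ bernPoly[c-N]-B≈-ΣrecipUnit (multiple-/ (+ (p ℕ.* n)) m (ℕD.m∣m*n n) p∤m) N ⟩
    ℚ.- Σ₁ N recipUnit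
      ≈⟨ ι[m]*ΣK≈-ΣrecipUnit m p∤m n ⟨
    ι m ℚ.* Σ₁ n (λ r → K p (+ r) m) ∎
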